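{- Let $k,\ell\ge 3$ be odd, $n=\frac{k\ell+1}{2}$, let $D_0,\dots,D_{n-1}$ be a partition of the edges of $BW_{k,\ell}$ into $n$ plane subgraphs, and let $E_{\text{forced}}$ be a set of forced diagonal edges for this partition, indexed so that $D_0$ contains exactly one edge $e$ of $E_{\text{forced}}$ and each $D_i$, $1\le i\le n-1$, contains exactly two edges $e_i,e_i'$ of $E_{\text{forced}}$. Let $x_0\ge 0$ be such that $\operatorname{dist}(e)=d_1-x_0$, and for $1\le i\le n-1$ let $x_i\ge 0$ be such that $\operatorname{dist}(e_i)+\operatorname{dist}(e_i')=2n-2-x_i$. Then \[\sum_{i=0}^{n-1}x_i\le\frac{\ell-1}{2}.\]
   Context: A geometric graph has vertices as points in general position and straight-line edges; it is plane if no two edges share a point of their relative interiors. For odd $k,\ell\ge 3$, $BW_{k,\ell}$ is the complete geometric graph on $k\ell+1$ points: a center $v_0$ and $k$ groups $\mathcal{G}_1,\dots,\mathcal{G}_k$ (clockwise, indices mod $k$) of $\ell$ points each, where group $\mathcal{G}_i$ consists of $\ell$ points that are $\varepsilon$-close (sufficiently small $\varepsilon>0$) to the $i$-th vertex of a regular $k$-gon centered at $v_0$, all points other than $v_0$ are in convex position on the convex hull, and the convex hull of any $\frac{k+1}{2}$ consecutive groups does not contain $v_0$. Edges incident to $v_0$ are radial; edges between hull-consecutive vertices are boundary edges; all others are diagonal. For a non-radial edge $e$, $e^-$ is the open halfplane bounded by the line through $e$ not containing $v_0$; an edge lies in $e^-$ if its relative interior does. For non-radial edges, $e<_cf$ if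 $e$ lies in $f^-$. A non-radial edge $e$ is maximal in a subgraph $D$ if there is no non-radial edge $e'$ of $D$ with $e<_ce'$. The distance $\operatorname{dist}(e)$ of a non-radial edge is the number of points of $BW_{k,\ell}$ in $e^-$ plus one; $d_i=\frac{k+1}{2}\ell-i$. Groups $\mathcal{G}_i,\mathcal{G}_j$ are opposite if $|i-j|\in\{\frac{k-1}{2},\frac{k+1}{2}\}$. A set of forced diagonal edges is a set $E_{\text{forced}}$ obtained by choosing, for each pair $\mathcal{G},\mathcal{G}'$ of opposite groups, $\ell$ distinct diagonal edges $f_1,\dots,f_\ell$ connecting $\mathcal{G}$ and $\mathcal{G}'$, each maximal in the subgraph $D_j$ containing it, with $\operatorname{dist}(f_i)\ge d_i$ for $i=1,\dots,\ell$. -}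

module Defs where

open import Data.Nat using (ℕ; zero; suc; _+_; _*_; _∸_; _≤_; _<_; _≤?_; _<?_; ∣_-_∣)
open import Data.Nat.Properties using (_≟_)
open import Data.Fin using (Fin; toℕ)
open import Data.Fin.Properties using () renaming (_≟_ to _≟ᶠ_)
open import Data.Product using (Σ; _×_; _,_; proj₁; proj₂)
open import Data.Product.Properties using (≡-dec)
open import Data.Sum using (_⊎_)
open import Data.Empty using (⊥)
open import Data.Unit using (⊤)
open import Data.List using (List; length; filter; cartesianProduct; allFin)
open import Relation.Nullary using (¬_; Dec; yes; no)
open import Relation.Nullary.Decidable using (_×-dec_; _⊎-dec_)
open import Relation.Binary.PropositionalEquality using (_≡_)

-- Hull points are pairs (g , p) : Fin k × Fin ℓ  (group g, position p inside
-- the group); the clockwise order along the convex hull is the lexicographic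
-- one, i.e. the linear index  idx (g , p) = g * ℓ + p  (cyclically mod kℓ).
-- The center v₀ is not a hull point; radial edges are  radial q  = v₀q.
module BW (k ℓ : ℕ) where

  m : ℕ
  m = (k ∸ 1) / 2
    where open import Data.Nat using (_/_)

  N : ℕ
  N = k * ℓ

  n : ℕ
  n = (N + 1) / 2
    where open import Data.Nat using (_/_)

  d : ℕ → ℕ
  d i = ((k + 1) / 2) * ℓ ∸ i
    where open import Data.Nat using (_/_)

  Pt : Set
  Pt = Fin k × Fin ℓ

  grp : Pt → ℕ
  grp q = toℕ (proj₁ q)

  idx : Pt → ℕ
  idx (g , p) = toℕ g * ℓ + toℕ p

  data Edge : Set where
    radial : Pt → Edge
    chord  : (a b : Pt) → idx a < idx b → Edge

  NonRadial : Edge → Set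
  NonRadial (radial _)    = ⊥
  NonRadial (chord _ _ _) = ⊤

  -- q lies in the open halfplane (ab)⁻ not containing v₀.
  -- Since v₀ is not in the hull of any (k+1)/2 consecutive groups, (ab)⁻ is
  -- the side of the arc from a to b spanning at most (k+1)/2 groups.
  InMinusPt : (a b q : Pt) → Set
  InMinusPt a b q =
      (grp b ∸ grp a ≤ m × idx a < idx q × idx q < idx b)
    ⊎ (m < grp b ∸ grp a × (idx q < idx a ⊎ idx b < idx q))

  inMinusPt? : (a b q : Pt) → Dec (InMinusPt a b q)
  inMinusPt? a b q =
      ((grp b ∸ grp a ≤? m) ×-dec ((idx a <? idx q) ×-dec (idx q <? idx b)))
    ⊎-dec ((m <? grp b ∸ grp a) ×-dec ((idx q <? idx a) ⊎-dec (idx b <? idx q)))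

  points : List Pt
  points = cartesianProduct (allFin k) (allFin ℓ)

  -- dist(e) = number of points of BW_{k,ℓ} in e⁻ plus one (v₀ is never in e⁻)
  dist : Edge → ℕ
  dist (radial _)    = 0   -- not used: dist is only defined for non-radial edges
  dist (chord a b _) = suc (length (filter (inMinusPt? a b) points))

  Boundary : Edge → Set
  Boundary (radial _)    = ⊥
  Boundary (chord a b _) = (idx b ≡ suc (idx a)) ⊎ (idx a ≡ 0 × suc (idx b) ≡ N)

  Diagonal : Edge → Set
  Diagonal (radial _)      = ⊥
  Diagonal e@(chord _ _ _) = ¬ Boundary e

  -- two edges share a point of their relative interiors (general position)
  Cross : Edge → Edge → Set
  Cross (radial _)    (radial _)    = ⊥
  Cross (radial q)    (chord a b _) = InMinusPt a b q
  Cross (chord a b _) (radial q)    = InMinusPt a b q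
  Cross (chord a b _) (chord c e _) =
      (idx a < idx c × idx c < idx b × idx b < idx e)
    ⊎ (idx c < idx a × idx a < idx e × idx e < idx b)

  -- a colouring c : Edge → Fin j is a partition of the edges into the
  -- subgraphs D_i = c⁻¹(i); it is into plane subgraphs if no two edges of
  -- the same class cross
  PlanePartition : ∀ {j} → (Edge → Fin j) → Set
  PlanePartition c = ∀ e f → c e ≡ c f → ¬ Cross e f

  InMinusClosed : (a b q : Pt) → Set
  InMinusClosed a b q = InMinusPt a b q ⊎ (q ≡ a ⊎ q ≡ b)

  LiesIn : Edge → Edge → Set
  LiesIn (chord c e _) (chord a b _) =
    InMinusClosed a b c × InMinusClosed a b e × ¬ (c ≡ a × e ≡ b)
  LiesIn _ _ = ⊥

  _<c_ : Edge → Edge → Set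
  e <c f = NonRadial e × NonRadial f × LiesIn e f

  MaximalIn : ∀ {j} → (Edge → Fin j) → Edge → Set
  MaximalIn c f = ∀ e' → NonRadial e' → c e' ≡ c f → ¬ (f <c e')

  Opposite : Fin k → Fin k → Set
  Opposite i j = (∣ toℕ i - toℕ j ∣ ≡ m) ⊎ (∣ toℕ i - toℕ j ∣ ≡ (k + 1) / 2)
    where open import Data.Nat using (_/_)

  Connects : Edge → Fin k → Fin k → Set
  Connects (radial _)    i j = ⊥
  Connects (chord a b _) i j = (proj₁ a ≡ i × proj₁ b ≡ j) ⊎ (proj₁ a ≡ j × proj₁ b ≡ i)

  IsForcedSet : ∀ {j} → (Edge → Fin j) → (Edge → Set) → Set
  IsForcedSet c Forced =
      (∀ f → Forced f → Σ (Fin k) λ i → Σ (Fin k) λ j → Opposite i j × Connects f i j)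
    × (∀ (i j : Fin k) → toℕ i < toℕ j → Opposite i j →
         Σ (Fin ℓ → Edge) λ fs →
             (∀ s t → fs s ≡ fs t → s ≡ t)
           × (∀ t → Forced (fs t) × Diagonal (fs t) × Connects (fs t) i j
                    × MaximalIn c (fs t) × d (suc (toℕ t)) ≤ dist (fs t))
           × (∀ f → Forced f → Connects f i j → Σ (Fin ℓ) λ t → f ≡ fs t))

{-# OPTIONS --safe #-}

-- The bound is pure counting: planarity and maximality are only needed to produce the forced set.
-- For k = 2a + 1 the opposite pairs of groups are the a + 1 pairs at index distance a and the a
-- pairs at distance a + 1, so the forced set is covered by k families f₁, …, f_ℓ with
-- dist(f_t) ≥ d_t.  The edges e, eᵢ, eᵢ′ are 2n − 1 = kℓ distinct forced edges (their colours
-- separate them), so by pigeonhole their distances add up to at least k(d₁ + ⋯ + d_ℓ).  Adding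
-- the equations defining the xᵢ gives Σ xᵢ + k(d₁ + ⋯ + d_ℓ) ≤ d₁ + (n − 1)(2n − 2), and for
-- ℓ = 2b + 1 Gauss' formula turns the right-hand side into b + k(d₁ + ⋯ + d_ℓ).

module Submission where

open import Defs
open import Data.Nat using (ℕ; zero; suc; _+_; _*_; _∸_; _≤_; _<_; _%_; _/_; ∣_-_∣; z≤n; s≤s; s≤s⁻¹)
open import Data.Nat.Properties
open import Data.Nat.DivMod using (m≡m%n+[m/n]*n; m*n/n≡m)
open import Data.Nat.ListAction using (sum)
open import Data.Nat.ListAction.Properties using (sum-++)
open import Data.Nat.Tactic.RingSolver using (solve-∀)
open import Data.Fin using (Fin; toℕ; fromℕ<) renaming (zero to fzero; suc to fsuc)
open import Data.Fin.Properties using (toℕ-fromℕ<; toℕ<n; toℕ-injective)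
open import Data.Product using (Σ; _×_; _,_; proj₁; proj₂)
open import Data.Sum using (_⊎_; inj₁; inj₂)
import Data.Sum as Sum
open import Data.List using (List; []; _∷_; _++_; length; map; concatMap; tabulate; allFin)
open import Data.List.Properties using (length-++; length-removeAt′; length-tabulate; map-++; map-tabulate)
open import Data.List.Relation.Unary.Any as Any using (Any; here; there; _─_; index)
import Data.List.Relation.Unary.Any.Properties as Any
open import Data.List.Relation.Unary.All as All using (All; []; _∷_)
import Data.List.Relation.Unary.All.Properties as All
open import Data.List.Relation.Unary.AllPairs using ([]; _∷_)
open import Data.List.Relation.Unary.Unique.Propositional using (Unique)
import Data.List.Relation.Unary.Unique.Propositional.Properties as Unique
open import Data.List.Relation.Binary.Disjoint.Propositional using (Disjoint)
open import Relation.Nullary using (¬_; contradiction)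
open import Relation.Binary using (tri<; tri≈; tri>)
open import Relation.Binary.PropositionalEquality
open import Algebra.Properties.CommutativeSemigroup +-commutativeSemigroup using (x∙yz≈y∙xz; interchange)

module _ {I : Set} where

  sum-map-+ : ∀ (f g : I → ℕ) is → sum (map f is) + sum (map g is) ≡ sum (map (λ i → f i + g i) is)
  sum-map-+ f g []       = refl
  sum-map-+ f g (i ∷ is) = trans (interchange (f i) _ (g i) _) (cong (f i + g i +_) (sum-map-+ f g is))

  sum-map-const : ∀ {f : I → ℕ} {s} {is} → All (λ i → f i ≡ s) is → sum (map f is) ≡ length is * s
  sum-map-const []         = refl
  sum-map-const (eq ∷ eqs) = cong₂ _+_ eq (sum-map-const eqs)

module _ {A I : Set} where

  sum-concatMap : ∀ (w : A → ℕ) (f : I → List A) is →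
                  sum (map w (concatMap f is)) ≡ sum (map (λ i → sum (map w (f i))) is)
  sum-concatMap w f []       = refl
  sum-concatMap w f (i ∷ is) = begin
    sum (map w (f i ++ concatMap f is))                ≡⟨ cong sum (map-++ w (f i) _) ⟩
    sum (map w (f i) ++ map w (concatMap f is))         ≡⟨ sum-++ (map w (f i)) _ ⟩
    sum (map w (f i)) + sum (map w (concatMap f is))    ≡⟨ cong (sum (map w (f i)) +_) (sum-concatMap w f is) ⟩
    sum (map w (f i)) + sum (map (λ i → sum (map w (f i))) is) ∎
    where open ≡-Reasoning

  length-concatMap : ∀ (f : I → List A) {m} {is} → All (λ i → length (f i) ≡ m) is →
                     length (concatMap f is) ≡ length is * m
  length-concatMap f []                       = refl
  length-concatMap f {is = i ∷ is} (eq ∷ eqs) = trans (length-++ (f i)) (cong₂ _+_ eq (length-concatMap f eqs))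

  All-concatMap⁺ : ∀ {P : A → Set} (f : I → List A) → (∀ i → All P (f i)) → ∀ is → All P (concatMap f is)
  All-concatMap⁺ f all-f is = All.concat⁺ (All.map⁺ (All.universal all-f is))

  Unique-concatMap⁺ : ∀ (colour : A → I) (f : I → List A) → (∀ i → Unique (f i)) →
                      (∀ i → All (λ x → colour x ≡ i) (f i)) → ∀ {is} → Unique is → Unique (concatMap f is)
  Unique-concatMap⁺ colour f unique-f coloured {[]}     []              = []
  Unique-concatMap⁺ colour f unique-f coloured {i ∷ is} (i∉is ∷ unique) =
    Unique.++⁺ (unique-f i) (Unique-concatMap⁺ colour f unique-f coloured unique) disjoint
    where
    other-colours : All (λ x → colour x ≢ i) (concatMap f is)
    other-colours = All.concat⁺ (All.map⁺ (All.map
      (λ i≢j → All.map (λ cx≡j cx≡i → i≢j (trans (sym cx≡i) cx≡j)) (coloured _)) i∉is))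
    disjoint : Disjoint (f i) (concatMap f is)
    disjoint (x∈fi , x∈rest) = All.lookup other-colours x∈rest (All.lookup (coloured i) x∈fi)

HasKey : {A B : Set} → List (A × B) → A → Set
HasKey T x = Any (λ p → x ≡ proj₁ p) T

HasKey-─ : ∀ {A B : Set} {x y : A} (T : List (A × B)) (q : HasKey T y) →
           HasKey T x → x ≢ y → HasKey (T ─ q) x
HasKey-─ (_ ∷ _) (here refl) (here refl) x≢y = contradiction refl x≢y
HasKey-─ (_ ∷ _) (here _)    (there p)   _   = p
HasKey-─ (_ ∷ _) (there _)   (here refl) _   = here refl
HasKey-─ (_ ∷ T) (there q)   (there p)   x≢y = there (HasKey-─ T q p x≢y)

module _ {A : Set} (w : A → ℕ) where

  Bounded : A × ℕ → Set
  Bounded (x , β) = β ≤ w x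

  sum-bounds-─ : ∀ {x} T (q : HasKey T x) → All Bounded T →
                 sum (map proj₂ T) ≤ w x + sum (map proj₂ (T ─ q))
  sum-bounds-─ (_ ∷ _) (here refl) (β≤wx ∷ _) = +-monoˡ-≤ _ β≤wx
  sum-bounds-─ {x} ((_ , β) ∷ T) (there q) (_ ∷ bounded) = begin
    β + sum (map proj₂ T)               ≤⟨ +-monoʳ-≤ β (sum-bounds-─ T q bounded) ⟩
    β + (w x + sum (map proj₂ (T ─ q))) ≡⟨ x∙yz≈y∙xz β (w x) _ ⟩
    w x + (β + sum (map proj₂ (T ─ q))) ∎
    where open ≤-Reasoning

  -- A pigeonhole argument: T is too short to list a key of L twice.
  sum-bounds≤sum-weights : ∀ (L : List A) T → Unique L → All (HasKey T) L →
                           All Bounded T → length T ≤ length L →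
                           sum (map proj₂ T) ≤ sum (map w L)
  sum-bounds≤sum-weights []      []      _                _              _       _       = z≤n
  sum-bounds≤sum-weights (x ∷ L) T       (x∉L ∷ unique) (q ∷ covered) bounded |T|≤|L| =
    ≤-trans (sum-bounds-─ T q bounded)
      (+-monoʳ-≤ (w x)
        (sum-bounds≤sum-weights L (T ─ q) unique covered′ (All.─⁺ q bounded)
          (s≤s⁻¹ (subst (_≤ suc (length L)) (length-removeAt′ T (index q)) |T|≤|L|))))
    where
    covered′ : All (HasKey (T ─ q)) L
    covered′ = All.zipWith (λ (p , x≢y) → HasKey-─ T q p (≢-sym x≢y)) (covered , x∉L)

m≤n⇒n≡m+∣m-n∣ : ∀ {m n} → m ≤ n → n ≡ m + ∣ m - n ∣
m≤n⇒n≡m+∣m-n∣ {m} m≤n = trans (sym (m+[n∸m]≡n m≤n)) (cong (m +_) (sym (m≤n⇒∣m-n∣≡n∸m m≤n)))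

-- Gauss: Σ_{t<n} (D − 1 − t) = nD − n(n + 1)/2, doubled and with the subtraction moved across.
sum-tabulate-∸suc : ∀ n D → n ≤ D →
                    sum (tabulate {n = n} (λ t → D ∸ suc (toℕ t))) * 2 + n * suc n ≡ n * D * 2
sum-tabulate-∸suc zero    D       _         = refl
sum-tabulate-∸suc (suc n) (suc D) (s≤s n≤D) = begin
  (D + S) * 2 + suc n * suc (suc n)        ≡⟨ shift D S n ⟩
  D * 2 + suc n * 2 + (S * 2 + n * suc n)   ≡⟨ cong (D * 2 + suc n * 2 +_) (sum-tabulate-∸suc n D n≤D) ⟩
  D * 2 + suc n * 2 + n * D * 2             ≡⟨ unshift D n ⟩
  suc n * suc D * 2                         ∎
  where
  open ≡-Reasoning
  S : ℕ
  S = sum (tabulate {n = n} (λ t → D ∸ suc (toℕ t)))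
  shift : ∀ D S n → (D + S) * 2 + suc n * suc (suc n) ≡ D * 2 + suc n * 2 + (S * 2 + n * suc n)
  shift = solve-∀
  unshift : ∀ D n → D * 2 + suc n * 2 + n * D * 2 ≡ suc n * suc D * 2
  unshift = solve-∀

module ForcedEdges (k ℓ : ℕ) where
  open BW k ℓ

  m₊ : ℕ
  m₊ = (k + 1) / 2

  OppositePair : Set
  OppositePair = Σ (Fin k) λ i → Σ (Fin k) λ j → toℕ i < toℕ j × Opposite i j

  sum-d : ℕ
  sum-d = sum (tabulate {n = ℓ} λ t → d (suc (toℕ t)))

  Opposite-sym : ∀ {i j} → Opposite i j → Opposite j i
  Opposite-sym {i} {j} = Sum.map (trans (∣-∣-comm (toℕ j) (toℕ i))) (trans (∣-∣-comm (toℕ j) (toℕ i)))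

  Connects-sym : ∀ f {i j} → Connects f i j → Connects f j i
  Connects-sym (chord _ _ _) = Sum.swap

  Joins : OppositePair → Fin k → Fin k → Set
  Joins (i′ , j′ , _) i j = i′ ≡ i × j′ ≡ j

  pairAt : ∀ i {δ} → 0 < δ → δ ≡ m ⊎ δ ≡ m₊ → i + δ < k → OppositePair
  pairAt i {δ} 0<δ δ-opposite i+δ<k = fromℕ< i<k , fromℕ< i+δ<k , i<i+δ , opposite
    where
    i<k : i < k
    i<k = ≤-<-trans (m≤m+n i δ) i+δ<k
    i<i+δ : toℕ (fromℕ< i<k) < toℕ (fromℕ< i+δ<k)
    i<i+δ = subst₂ _<_ (sym (toℕ-fromℕ< i<k)) (sym (toℕ-fromℕ< i+δ<k)) (m<m+n i 0<δ)
    opposite : Opposite (fromℕ< i<k) (fromℕ< i+δ<k)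
    opposite = subst (λ x → x ≡ m ⊎ x ≡ m₊)
      (sym (trans (cong₂ ∣_-_∣ (toℕ-fromℕ< i<k) (toℕ-fromℕ< i+δ<k)) (∣m-m+n∣≡n i δ))) δ-opposite

  pairsAt : ∀ r {δ} → r + δ ≡ k → 0 < δ → δ ≡ m ⊎ δ ≡ m₊ → List OppositePair
  pairsAt r {δ} r+δ≡k 0<δ δ-opposite =
    tabulate λ (i : Fin r) →
      pairAt (toℕ i) 0<δ δ-opposite (subst (toℕ i + δ <_) r+δ≡k (+-monoˡ-< δ (toℕ<n i)))

  length-pairsAt : ∀ r {δ} (r+δ≡k : r + δ ≡ k) 0<δ δ-opposite → length (pairsAt r r+δ≡k 0<δ δ-opposite) ≡ r
  length-pairsAt r r+δ≡k 0<δ δ-opposite = length-tabulate _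

  pairsAt-complete : ∀ r {δ} (r+δ≡k : r + δ ≡ k) 0<δ δ-opposite (i j : Fin k) → toℕ j ≡ toℕ i + δ →
                     Any (λ π → Joins π i j) (pairsAt r r+δ≡k 0<δ δ-opposite)
  pairsAt-complete r {δ} r+δ≡k 0<δ δ-opposite i j j≡i+δ =
    Any.tabulate⁺ t (toℕ-injective (trans (toℕ-fromℕ< _) toℕt≡i) ,
                     toℕ-injective (trans (toℕ-fromℕ< _) (trans (cong (_+ δ) toℕt≡i) (sym j≡i+δ))))
    where
    i<r : toℕ i < r
    i<r = +-cancelʳ-< δ (toℕ i) r (subst₂ _<_ j≡i+δ (sym r+δ≡k) (toℕ<n j))
    t : Fin r
    t = fromℕ< i<r
    toℕt≡i : toℕ t ≡ toℕ i
    toℕt≡i = toℕ-fromℕ< i<r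

  module _ (0<m : 0 < m) (0<m₊ : 0 < m₊) (m+m₊≡k : m + m₊ ≡ k) where

    m₊+m≡k : m₊ + m ≡ k
    m₊+m≡k = trans (+-comm m₊ m) m+m₊≡k

    ¬Opposite-≡ : ∀ {i j} → toℕ i ≡ toℕ j → ¬ Opposite i j
    ¬Opposite-≡ i≡j (inj₁ ∣i-j∣≡m)  = <⇒≢ 0<m  (trans (sym (m≡n⇒∣m-n∣≡0 i≡j)) ∣i-j∣≡m)
    ¬Opposite-≡ i≡j (inj₂ ∣i-j∣≡m₊) = <⇒≢ 0<m₊ (trans (sym (m≡n⇒∣m-n∣≡0 i≡j)) ∣i-j∣≡m₊)

    oppositePairs : List OppositePair
    oppositePairs = pairsAt m₊ m₊+m≡k 0<m (inj₁ refl) ++ pairsAt m m+m₊≡k 0<m₊ (inj₂ refl)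

    length-oppositePairs : length oppositePairs ≡ k
    length-oppositePairs = begin
      length oppositePairs                                 ≡⟨ length-++ (pairsAt m₊ m₊+m≡k 0<m (inj₁ refl)) ⟩
      length (pairsAt m₊ m₊+m≡k 0<m (inj₁ refl)) + length (pairsAt m m+m₊≡k 0<m₊ (inj₂ refl))
        ≡⟨ cong₂ _+_ (length-pairsAt m₊ m₊+m≡k 0<m (inj₁ refl)) (length-pairsAt m m+m₊≡k 0<m₊ (inj₂ refl)) ⟩
      m₊ + m                                               ≡⟨ m₊+m≡k ⟩
      k                                                    ∎
      where open ≡-Reasoning

    oppositePairs-complete : ∀ i j → toℕ i < toℕ j → Opposite i j → Any (λ π → Joins π i j) oppositePairs
    oppositePairs-complete i j i<j (inj₁ ∣i-j∣≡m) =
      Any.++⁺ˡ (pairsAt-complete m₊ m₊+m≡k 0<m (inj₁ refl) i j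
                 (trans (m≤n⇒n≡m+∣m-n∣ (<⇒≤ i<j)) (cong (toℕ i +_) ∣i-j∣≡m)))
    oppositePairs-complete i j i<j (inj₂ ∣i-j∣≡m₊) =
      Any.++⁺ʳ (pairsAt m₊ m₊+m≡k 0<m (inj₁ refl)) (pairsAt-complete m m+m₊≡k 0<m₊ (inj₂ refl) i j
                 (trans (m≤n⇒n≡m+∣m-n∣ (<⇒≤ i<j)) (cong (toℕ i +_) ∣i-j∣≡m₊)))

    module _ {N} {c : Edge → Fin N} {Forced : Edge → Set} (isForced : IsForcedSet c Forced) where

      forcedFamily : OppositePair → Fin ℓ → Edge
      forcedFamily (i , j , i<j , opposite) = proj₁ (proj₂ isForced i j i<j opposite)

      d≤dist-forcedFamily : ∀ π t → d (suc (toℕ t)) ≤ dist (forcedFamily π t)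
      d≤dist-forcedFamily (i , j , i<j , opposite) t with proj₂ isForced i j i<j opposite
      ... | _ , _ , properties , _ = let (_ , _ , _ , _ , d≤dist) = properties t in d≤dist

      forcedFamily-complete : ∀ {f} π → Forced f → Connects f (proj₁ π) (proj₁ (proj₂ π)) →
                              Σ (Fin ℓ) λ t → f ≡ forcedFamily π t
      forcedFamily-complete {f} (i , j , i<j , opposite) =
        proj₂ (proj₂ (proj₂ (proj₂ isForced i j i<j opposite))) f

      boundedBlock : OppositePair → List (Edge × ℕ)
      boundedBlock π = tabulate λ t → forcedFamily π t , d (suc (toℕ t))

      boundedForced : List (Edge × ℕ)
      boundedForced = concatMap boundedBlock oppositePairs

      boundedForced-bounded : All (Bounded dist) boundedForced
      boundedForced-bounded =
        All-concatMap⁺ boundedBlock (λ π → All.tabulate⁺ (d≤dist-forcedFamily π)) oppositePairs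

      sum-bounds-boundedBlock : ∀ π → sum (map proj₂ (boundedBlock π)) ≡ sum-d
      sum-bounds-boundedBlock π = cong sum (map-tabulate (λ t → forcedFamily π t , d (suc (toℕ t))) proj₂)

      length-boundedForced : length boundedForced ≡ k * ℓ
      length-boundedForced =
        trans (length-concatMap boundedBlock (All.universal (λ _ → length-tabulate _) oppositePairs))
              (cong (_* ℓ) length-oppositePairs)

      sum-bounds-boundedForced : sum (map proj₂ boundedForced) ≡ k * sum-d
      sum-bounds-boundedForced = begin
        sum (map proj₂ boundedForced)
          ≡⟨ sum-concatMap proj₂ boundedBlock oppositePairs ⟩
        sum (map (λ π → sum (map proj₂ (boundedBlock π))) oppositePairs)
          ≡⟨ sum-map-const (All.universal sum-bounds-boundedBlock oppositePairs) ⟩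
        length oppositePairs * sum-d
          ≡⟨ cong (_* sum-d) length-oppositePairs ⟩
        k * sum-d
          ∎
        where open ≡-Reasoning

      HasKey-boundedForced-< : ∀ {f} i j → toℕ i < toℕ j → Opposite i j → Forced f → Connects f i j →
                               HasKey boundedForced f
      HasKey-boundedForced-< {f} i j i<j opposite forced connects =
        Any.concat⁺ (Any.map⁺ (Any.map inBlock (oppositePairs-complete i j i<j opposite)))
        where
        inBlock : ∀ {π} → Joins π i j → HasKey (boundedBlock π) f
        inBlock {π} (refl , refl) = let (t , f≡ft) = forcedFamily-complete π forced connects
                                    in Any.tabulate⁺ {P = λ p → f ≡ proj₁ p} t f≡ft

      HasKey-boundedForced : ∀ {f} → Forced f → HasKey boundedForced f
      HasKey-boundedForced {f} forced with proj₁ isForced f forced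
      ... | i , j , opposite , connects with <-cmp (toℕ i) (toℕ j)
      ...   | tri< i<j _ _ = HasKey-boundedForced-< i j i<j opposite forced connects
      ...   | tri≈ _ i≡j _ = contradiction opposite (¬Opposite-≡ i≡j)
      ...   | tri> _ _ j<i =
        HasKey-boundedForced-< j i j<i (Opposite-sym {i} {j} opposite) forced (Connects-sym f connects)

      k*sum-d≤sum-dist : ∀ L → Unique L → All Forced L → k * ℓ ≤ length L → k * sum-d ≤ sum (map dist L)
      k*sum-d≤sum-dist L unique forced kℓ≤|L| = subst (_≤ sum (map dist L)) sum-bounds-boundedForced
        (sum-bounds≤sum-weights dist L boundedForced unique (All.map HasKey-boundedForced forced)
          boundedForced-bounded (subst (_≤ length L) (sym length-boundedForced) kℓ≤|L|))

module Listed {A : Set} {N : ℕ} (e : A) (eA eB : Fin (suc N) → A) where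

  block : Fin (suc N) → List A
  block fzero    = e ∷ []
  block (fsuc j) = eA (fsuc j) ∷ eB (fsuc j) ∷ []

  listed : List A
  listed = concatMap block (allFin (suc N))

  length-listed : length listed ≡ suc (N * 2)
  length-listed = cong suc (trans (length-concatMap block (All.tabulate⁺ {f = fsuc} λ _ → refl))
                                 (cong (_* 2) (length-tabulate {n = N} fsuc)))

  All-listed : ∀ {P : A → Set} → P e → (∀ j → P (eA (fsuc j)) × P (eB (fsuc j))) → All P listed
  All-listed {P} pe pAB = All-concatMap⁺ block all-block (allFin (suc N))
    where
    all-block : ∀ j → All P (block j)
    all-block fzero    = pe ∷ []
    all-block (fsuc j) = proj₁ (pAB j) ∷ proj₂ (pAB j) ∷ []

  Unique-listed : (colour : A → Fin (suc N)) → colour e ≡ fzero →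
                  (∀ j → colour (eA (fsuc j)) ≡ fsuc j × colour (eB (fsuc j)) ≡ fsuc j
                         × eA (fsuc j) ≢ eB (fsuc j)) →
                  Unique listed
  Unique-listed colour colour-e colour-AB =
    Unique-concatMap⁺ colour block unique coloured (Unique.allFin⁺ (suc N))
    where
    unique : ∀ j → Unique (block j)
    unique fzero    = [] ∷ []
    unique (fsuc j) = (proj₂ (proj₂ (colour-AB j)) ∷ []) ∷ [] ∷ []
    coloured : ∀ j → All (λ x → colour x ≡ j) (block j)
    coloured fzero    = colour-e ∷ []
    coloured (fsuc j) = proj₁ (colour-AB j) ∷ proj₁ (proj₂ (colour-AB j)) ∷ []

  sum-listed : ∀ (w : A → ℕ) (x : Fin (suc N) → ℕ) {s₀ s} → w e + x fzero ≡ s₀ →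
               (∀ j → w (eA (fsuc j)) + w (eB (fsuc j)) + x (fsuc j) ≡ s) →
               sum (map x (allFin (suc N))) + sum (map w listed) ≡ s₀ + N * s
  sum-listed w x {s₀} {s} excess-e excess-AB = begin
    sum (map x all) + sum (map w listed)                           ≡⟨ cong (sum (map x all) +_) (sum-concatMap w block all) ⟩
    sum (map x all) + sum (map (λ j → sum (map w (block j))) all)  ≡⟨ sum-map-+ x _ all ⟩
    sum (map (λ j → x j + sum (map w (block j))) all)              ≡⟨ cong₂ _+_ block₀ blocks ⟩
    s₀ + N * s                                                     ∎
    where
    open ≡-Reasoning
    all : List (Fin (suc N))
    all = allFin (suc N)
    rearrange : ∀ x w₀ → x + (w₀ + 0) ≡ w₀ + x
    rearrange = solve-∀
    rearrange₂ : ∀ x wA wB → x + (wA + (wB + 0)) ≡ wA + wB + x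
    rearrange₂ = solve-∀
    block₀ : x fzero + (w e + 0) ≡ s₀
    block₀ = trans (rearrange (x fzero) (w e)) excess-e
    blockⱼ : ∀ j → x (fsuc j) + sum (map w (block (fsuc j))) ≡ s
    blockⱼ j = trans (rearrange₂ (x (fsuc j)) (w (eA (fsuc j))) (w (eB (fsuc j)))) (excess-AB j)
    blocks : sum (map (λ j → x j + sum (map w (block j))) (tabulate {n = N} fsuc)) ≡ N * s
    blocks = trans (sum-map-const (All.tabulate⁺ {f = fsuc} blockⱼ)) (cong (_* s) (length-tabulate {n = N} fsuc))

odd⇒≡suc-double : ∀ {k} → k % 2 ≡ 1 → Σ ℕ λ a → k ≡ suc (a * 2)
odd⇒≡suc-double {k} k%2≡1 = k / 2 , trans (m≡m%n+[m/n]*n k 2) (cong (_+ k / 2 * 2) k%2≡1)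

module OddParameters (a b : ℕ) where
  k ℓ n-1 : ℕ
  k = suc (a * 2)
  ℓ = suc (b * 2)
  n-1 = a * ℓ + b

  open BW k ℓ
  open ForcedEdges k ℓ

  m≡a : m ≡ a
  m≡a = m*n/n≡m a 2

  m₊≡1+a : m₊ ≡ suc a
  m₊≡1+a = trans (cong (_/ 2) (+-comm k 1)) (m*n/n≡m (suc a) 2)

  kℓ≡1+[n-1]*2 : k * ℓ ≡ suc (n-1 * 2)
  kℓ≡1+[n-1]*2 = expand a b
    where
    expand : ∀ a b → suc (a * 2) * suc (b * 2) ≡ suc ((a * suc (b * 2) + b) * 2)
    expand = solve-∀

  n≡1+n-1 : n ≡ suc n-1
  n≡1+n-1 = trans (cong (λ z → (z + 1) / 2) kℓ≡1+[n-1]*2)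
                  (trans (cong (_/ 2) (+-comm (suc (n-1 * 2)) 1)) (m*n/n≡m (suc n-1) 2))

  0<m : 3 ≤ k → 0 < m
  0<m 3≤k = subst (0 <_) (sym m≡a) (*-cancelʳ-≤ 1 a 2 (s≤s⁻¹ 3≤k))

  0<m₊ : 0 < m₊
  0<m₊ = subst (0 <_) (sym m₊≡1+a) (s≤s z≤n)

  m+m₊≡k : m + m₊ ≡ k
  m+m₊≡k = trans (cong₂ _+_ m≡a m₊≡1+a) (a+[1+a]≡k a)
    where
    a+[1+a]≡k : ∀ a → a + suc a ≡ suc (a * 2)
    a+[1+a]≡k = solve-∀

  sum-d-closed : sum-d * 2 + ℓ * suc ℓ ≡ ℓ * (suc a * ℓ) * 2
  sum-d-closed =
    subst (λ h → sum (tabulate {n = ℓ} λ t → h * ℓ ∸ suc (toℕ t)) * 2 + ℓ * suc ℓ ≡ ℓ * (suc a * ℓ) * 2)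
          (sym m₊≡1+a) (sum-tabulate-∸suc ℓ (suc a * ℓ) (m≤m+n ℓ (a * ℓ)))

  excess-identity : b * 2 + a * ℓ + n-1 * (n-1 * 2) ≡ b + k * sum-d
  excess-identity = *-cancelʳ-≡ _ _ 2 (+-cancelʳ-≡ (k * (ℓ * suc ℓ)) _ _ (begin
    (b * 2 + a * ℓ + n-1 * (n-1 * 2)) * 2 + k * (ℓ * suc ℓ) ≡⟨ expand a b ⟩
    k * (ℓ * (suc a * ℓ) * 2) + b * 2                   ≡⟨ cong (λ z → k * z + b * 2) sum-d-closed ⟨
    k * (sum-d * 2 + ℓ * suc ℓ) + b * 2                 ≡⟨ collect k ℓ b sum-d ⟩
    (b + k * sum-d) * 2 + k * (ℓ * suc ℓ)               ∎))
    where
    open ≡-Reasoning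
    expand : ∀ a b → let ℓ = suc (b * 2); N = a * ℓ + b in
             (b * 2 + a * ℓ + N * (N * 2)) * 2 + suc (a * 2) * (ℓ * suc ℓ)
               ≡ suc (a * 2) * (ℓ * (suc a * ℓ) * 2) + b * 2
    expand = solve-∀
    collect : ∀ k ℓ b P → k * (P * 2 + ℓ * suc ℓ) + b * 2 ≡ (b + k * P) * 2 + k * (ℓ * suc ℓ)
    collect = solve-∀

  excess-bound : ∀ X → X + k * sum-d ≤ d 1 + n-1 * (2 * suc n-1 ∸ 2) → X ≤ (ℓ ∸ 1) / 2
  excess-bound X X+k*sum-d≤ = subst (X ≤_) (sym (m*n/n≡m b 2)) (+-cancelʳ-≤ (k * sum-d) X b (begin
    X + k * sum-d                ≤⟨ X+k*sum-d≤ ⟩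
    d 1 + n-1 * (2 * suc n-1 ∸ 2)   ≡⟨ cong₂ (λ u v → u + n-1 * v) (cong (λ h → h * ℓ ∸ 1) m₊≡1+a)
                                                                   (2[1+N]∸2≡N*2 n-1) ⟩
    b * 2 + a * ℓ + n-1 * (n-1 * 2) ≡⟨ excess-identity ⟩
    b + k * sum-d                ∎))
    where
    open ≤-Reasoning
    2[1+N]∸2≡N*2 : ∀ N → 2 * suc N ∸ 2 ≡ N * 2
    2[1+N]∸2≡N*2 N = trans (sym (*-distribˡ-∸ 2 (suc N) 1)) (*-comm 2 N)

proposition22 : (k ℓ : ℕ) → 3 ≤ k → 3 ≤ ℓ → k % 2 ≡ 1 → ℓ % 2 ≡ 1 →
    let open BW k ℓ in
    (c : Edge → Fin n) → PlanePartition c →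
    (Forced : Edge → Set) → IsForcedSet c Forced →
    (e : Edge) (eA eB : Fin n → Edge) →
    Forced e →
    (∀ j → toℕ j ≡ 0 → c e ≡ j × (∀ f → Forced f → c f ≡ j → f ≡ e)) →
    (∀ j → 1 ≤ toℕ j →
      Forced (eA j) × Forced (eB j) × eA j ≢ eB j × c (eA j) ≡ j × c (eB j) ≡ j
      × (∀ f → Forced f → c f ≡ j → f ≡ eA j ⊎ f ≡ eB j)) →
    (x : Fin n → ℕ) →
    (∀ j → toℕ j ≡ 0 → dist e + x j ≡ d 1) →
    (∀ j → 1 ≤ toℕ j → dist (eA j) + dist (eB j) + x j ≡ 2 * n ∸ 2) →
    sum (map x (allFin n)) ≤ (ℓ ∸ 1) / 2
proposition22 k ℓ 3≤k _ k-odd ℓ-odd with odd⇒≡suc-double {k} k-odd | odd⇒≡suc-double {ℓ} ℓ-odd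
-- n = (kℓ + 1)/2 does not compute to a successor; abstracting it lets Fin n be split.
... | a , refl | b , refl with BW.n (suc (a * 2)) (suc (b * 2)) | OddParameters.n≡1+n-1 a b
... | _ | refl = λ c _ Forced isForced e eA eB e-forced e-class pair-class x e-excess pair-excess →
  let open OddParameters a b using (n-1; kℓ≡1+[n-1]*2; 0<m; 0<m₊; m+m₊≡k; excess-bound)
      open BW k ℓ
      open ForcedEdges k ℓ using (sum-d; k*sum-d≤sum-dist)
      open Listed e eA eB
      open ≤-Reasoning
  in excess-bound (sum (map x (allFin (suc n-1)))) (begin
       sum (map x (allFin (suc n-1))) + k * sum-d
         ≤⟨ +-monoʳ-≤ (sum (map x (allFin (suc n-1))))
              (k*sum-d≤sum-dist (0<m 3≤k) 0<m₊ m+m₊≡k isForced listed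
                (Unique-listed c (proj₁ (e-class fzero refl)) λ j →
                   let (_ , _ , eA≢eB , cA , cB , _) = pair-class (fsuc j) (s≤s z≤n) in cA , cB , eA≢eB)
                (All-listed e-forced λ j →
                   let (fA , fB , _) = pair-class (fsuc j) (s≤s z≤n) in fA , fB)
                (≤-reflexive (trans kℓ≡1+[n-1]*2 (sym length-listed)))) ⟩
       sum (map x (allFin (suc n-1))) + sum (map dist listed)
         ≡⟨ sum-listed dist x (e-excess fzero refl) (λ j → pair-excess (fsuc j) (s≤s z≤n)) ⟩
       d 1 + n-1 * (2 * suc n-1 ∸ 2) ∎)
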